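{- Let $G$ be a finite connected multigraph with vertices $v_1,\dots,v_N$ ($N\ge2$), let $D_i=(v_i)-(v_N)$ for $i=1,\dots,N-1$, let $\phi:\mathbb{Z}^{N-1}\to{\rm Div}(G)/{\rm Prin}(G)$, $\phi(n)=[\sum_in_iD_i]$, and let $\mu_i$ be the order of $[D_i]$ in ${\rm Jac}(G)$. Then the Poincar\'e series $P_{G,D_1,\dots,D_{N-1}}(z_1,\dots,z_{N-1})=\sum_{n\in\mathbb{N}^{N-1}}(r_G(\sum_in_iD_i)+1)z^n$ is given by the rational function $$\frac{\sum_{\mathbf r\in B}\mathbf z^{\mathbf r}}{\prod_{i=1}^{N-1}(1-z_i^{\mu_i})},\qquad B=\{\mathbf r\in\ker\phi:\ 0\le r_i<\mu_i \text{ for } i=1,\dots,N-1\}.$$ Furthermore, for the complete graph $K_N$, $$P_{K_N,D_1,\dots,D_{N-1}}(z_1,\dots,z_{N-1})=\frac{1-(z_1\cdots z_{N-1})^N}{(1-z_1^N)\cdots(1-z_{N-1}^N)(1-z_1\cdots z_{N-1})}.$$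
   Context: $\mathbb{N}$ is the set of non-negative integers and $\mathbf z^{\mathbf r}=z_1^{r_1}\cdots z_{N-1}^{r_{N-1}}$. Divisors, principal divisors ${\rm div}(f)=\sum_u(\sum_{e=(u,v)}(f(u)-f(v)))(u)$, linear equivalence and the rank $r_G$ (equal to $-1$ if $D$ is not linearly equivalent to an effective divisor, otherwise the largest $r$ such that $D-E$ is linearly equivalent to an effective divisor for every effective $E$ of degree $r$) are the Baker–Norine notions on $G$; ${\rm Jac}(G)$ is the group of degree-zero divisors modulo principal divisors. -}

module Defs where

open import Data.Nat as ℕ using (ℕ; zero; suc; _∸_; _<_; _≤_)
open import Data.Integer as ℤ using (ℤ; +_; -_; _+_; _-_; _*_; 0ℤ; 1ℤ; -1ℤ)
open import Data.Fin as Fin using (Fin; fromℕ; inject₁)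
open import Data.Fin.Properties using (all?)
open import Data.List using (List; []; _∷_; [_]; map; concatMap; upTo; foldr)
open import Data.Vec.Functional using () renaming (_∷_ to _∷ᶠ_)
open import Data.Product using (Σ; Σ-syntax; ∃; _×_)
open import Data.Sum using (_⊎_)
open import Relation.Nullary using (¬_; yes; no)
open import Relation.Binary.PropositionalEquality using (_≡_)
open import Function using (_∘_)

sumFin : ∀ {n} → (Fin n → ℤ) → ℤ
sumFin {zero}  f = 0ℤ
sumFin {suc n} f = f Fin.zero + sumFin (f ∘ Fin.suc)

Mult : ℕ → Set
Mult V = Fin V → Fin V → ℕ

IsMultigraph : ∀ {V} → Mult V → Set
IsMultigraph A = (∀ u v → A u v ≡ A v u) × (∀ u → A u u ≡ 0)

data Path {V} (A : Mult V) : Fin V → Fin V → Set where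
  here : ∀ {u} → Path A u u
  step : ∀ {u w v} → 0 < A u w → Path A w v → Path A u v

Connected : ∀ {V} → Mult V → Set
Connected A = ∀ u v → Path A u v

complete : ∀ V → Mult V
complete V u v with u Fin.≟ v
... | yes _ = 0
... | no  _ = 1

Div : ℕ → Set
Div V = Fin V → ℤ

zeroDiv : ∀ {V} → Div V
zeroDiv _ = 0ℤ

_-ᴰ_ : ∀ {V} → Div V → Div V → Div V
(D -ᴰ E) u = D u - E u

deg : ∀ {V} → Div V → ℤ
deg D = sumFin D

divisor : ∀ {V} → Mult V → (Fin V → ℤ) → Div V
divisor A f u = sumFin (λ v → + (A u v) * (f u - f v))

_∼⟨_⟩_ : ∀ {V} → Div V → Mult V → Div V → Set
D ∼⟨ A ⟩ D' = Σ[ f ∈ (_ → ℤ) ] (∀ u → D u - D' u ≡ divisor A f u)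

Effective : ∀ {V} → Div V → Set
Effective D = ∀ u → ℤ._≤_ 0ℤ (D u)

LinEqEff : ∀ {V} → Mult V → Div V → Set
LinEqEff A D = Σ[ D' ∈ Div _ ] (Effective D' × D ∼⟨ A ⟩ D')

RankAtLeast : ∀ {V} → Mult V → Div V → ℕ → Set
RankAtLeast A D m = ∀ E → Effective E → deg E ≡ + m → LinEqEff A (D -ᴰ E)

IsRank : ∀ {V} → Mult V → Div V → ℤ → Set
IsRank A D r =
  (¬ LinEqEff A D × r ≡ -1ℤ) ⊎
  (LinEqEff A D × Σ[ m ∈ ℕ ] (r ≡ + m × RankAtLeast A D m
                              × (∀ m' → RankAtLeast A D m' → m' ≤ m)))

_·ᴰ_ : ∀ {V} → ℕ → Div V → Div V
(m ·ᴰ D) u = + m * D u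

IsOrder : ∀ {V} → Mult V → Div V → ℕ → Set
IsOrder A D m = 1 ≤ m × (m ·ᴰ D) ∼⟨ A ⟩ zeroDiv
              × (∀ j → 1 ≤ j → j < m → ¬ ((j ·ᴰ D) ∼⟨ A ⟩ zeroDiv))

-- vertices v_1..v_N are Fin (suc k) with v_N = fromℕ k;
-- D_i = (v_i) - (v_N) for i : Fin k
pt : ∀ {V} → Fin V → Div V
pt v u with v Fin.≟ u
... | yes _ = 1ℤ
... | no  _ = 0ℤ

Dᵢ : ∀ {k} → Fin k → Div (suc k)
Dᵢ {k} i = pt (inject₁ i) -ᴰ pt (fromℕ k)

combo : ∀ {k} → (Fin k → ℕ) → Div (suc k)
combo n u = sumFin (λ i → + (n i) * Dᵢ i u)

Series : ℕ → Set
Series k = (Fin k → ℕ) → ℤ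

box : ∀ {k} → (Fin k → ℕ) → List (Fin k → ℕ)
box {zero}  n = [ (λ ()) ]
box {suc k} n = concatMap (λ a₀ → map (λ t → a₀ ∷ᶠ t) (box (n ∘ Fin.suc)))
                          (upTo (suc (n Fin.zero)))

sumL : List ℤ → ℤ
sumL = foldr _+_ 0ℤ

_⊗_ : ∀ {k} → Series k → Series k → Series k
(f ⊗ g) n = sumL (map (λ a → f a * g (λ i → n i ∸ a i)) (box n))

_⊖_ : ∀ {k} → Series k → Series k → Series k
(f ⊖ g) n = f n - g n

mono : ∀ {k} → (Fin k → ℕ) → Series k
mono r n with all? (λ i → r i ℕ.≟ n i)
... | yes _ = 1ℤ
... | no  _ = 0ℤ

one : ∀ {k} → Series k
one = mono (λ _ → 0)

expo : ∀ {k} → Fin k → ℕ → (Fin k → ℕ)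
expo i m j with i Fin.≟ j
... | yes _ = m
... | no  _ = 0

prodFin : ∀ {k} n → (Fin n → Series k) → Series k
prodFin zero    F = one
prodFin (suc n) F = F Fin.zero ⊗ prodFin n (F ∘ Fin.suc)

denominator : ∀ {k} → (Fin k → ℕ) → Series k
denominator {k} μ = prodFin k (λ i → one ⊖ mono (expo i (μ i)))

-- Poincaré series P_{G,D_1..D_{N-1}}, given the rank function ρ(n) = r_G(Σ n_i D_i)
poincare : ∀ {k} → ((Fin k → ℕ) → ℤ) → Series k
poincare ρ n = ρ n + 1ℤ

InB : ∀ {k} → Mult (suc k) → (Fin k → ℕ) → (Fin k → ℕ) → Set
InB A μ r = (∀ i → r i < μ i) × (combo r ∼⟨ A ⟩ zeroDiv)

IsIndicatorSeries : ∀ {k} → ((Fin k → ℕ) → Set) → Series k → Set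
IsIndicatorSeries B s = ∀ n → (B n × s n ≡ 1ℤ) ⊎ (¬ B n × s n ≡ 0ℤ)

module Submission where

-- For a divisor of degree 0 the rank is 0 if the divisor is principal and -1 otherwise, so the
-- Poincaré series is the indicator series of ker φ ∩ ℕ^{N-1}.  Since every μ_i D_i is principal,
-- this set is invariant under adding μ_i to the i-th coordinate, and multiplying a series with
-- these periods by ∏ (1 - z_i^{μ_i}) keeps its coefficients on the box 0 ≤ n_i < μ_i and kills
-- all others.  On K_N every N D_i is principal, and a vector of the box lies in ker φ exactly
-- when all its entries are equal, so there the numerator is the geometric sum
-- Σ_{c<N} (z_1⋯z_{N-1})^c.

open import Defs
import Algebra.Properties.Ring
open import Data.Empty using (⊥-elim)
open import Data.Fin as Fin using (Fin; zero; suc; toℕ; fromℕ; inject₁)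
open import Data.Fin.Properties as FinP using (all?)
open import Data.Integer as ℤ using (ℤ; +_; -_; _+_; _-_; _*_; 0ℤ; 1ℤ)
open import Data.Integer.Properties as ℤP using ()
open import Data.Integer.Tactic.RingSolver using (solve-∀)
open import Data.List using (List; []; _∷_; map; concatMap; applyUpTo; _++_)
open import Data.List.Properties using (map-∘)
open import Data.Nat as ℕ using (ℕ; zero; suc; _≤_; _<_; _∸_; z≤n; s≤s)
open import Data.Nat.DivMod using (m<n⇒m%n≡m; [m+kn]%n≡m%n)
open import Data.Nat.Properties as ℕP using ()
open import Data.Product as Product using (Σ-syntax; _×_; _,_; proj₁; proj₂)
open import Data.Sum as Sum using (_⊎_; inj₁; inj₂)
open import Data.Vec.Functional using () renaming (_∷_ to _∷ᶠ_)
open import Data.Vec.Functional.Relation.Binary.Pointwise using (Pointwise)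
open import Function using (id; _∘_; _⇔_; mk⇔; Equivalence)
open import Relation.Binary.PropositionalEquality
open import Relation.Nullary using (¬_; yes; no)

open Algebra.Properties.Ring ℤP.+-*-ring using (x[y-z]≈xy-xz; [y-z]x≈yx-zx)

sumFin-cong : ∀ {n} {f g : Fin n → ℤ} → f ≗ g → sumFin f ≡ sumFin g
sumFin-cong {zero}  f≗g = refl
sumFin-cong {suc n} f≗g = cong₂ _+_ (f≗g zero) (sumFin-cong (f≗g ∘ suc))

sumFin-distrib-+ : ∀ {n} (f g : Fin n → ℤ) → sumFin (λ i → f i + g i) ≡ sumFin f + sumFin g
sumFin-distrib-+ {zero}  f g = refl
sumFin-distrib-+ {suc n} f g =
  trans (cong (_+_ (f zero + g zero)) (sumFin-distrib-+ (f ∘ suc) (g ∘ suc)))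
        (interchange (f zero) (g zero) _ _)
  where
  interchange : ∀ a b c d → a + b + (c + d) ≡ a + c + (b + d)
  interchange = solve-∀

sumFin-distrib-- : ∀ {n} (f g : Fin n → ℤ) → sumFin (λ i → f i - g i) ≡ sumFin f - sumFin g
sumFin-distrib-- {zero}  f g = refl
sumFin-distrib-- {suc n} f g =
  trans (cong (_+_ (f zero - g zero)) (sumFin-distrib-- (f ∘ suc) (g ∘ suc)))
        (interchange (f zero) (g zero) _ _)
  where
  interchange : ∀ a b c d → a - b + (c - d) ≡ a + c - (b + d)
  interchange = solve-∀

sumFin-neg : ∀ {n} (f : Fin n → ℤ) → sumFin (λ i → - f i) ≡ - sumFin f
sumFin-neg {zero}  f = refl
sumFin-neg {suc n} f =
  trans (cong (_+_ (- f zero)) (sumFin-neg (f ∘ suc))) (sym (ℤP.neg-distrib-+ (f zero) _))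

*-distribˡ-sumFin : ∀ {n} s (f : Fin n → ℤ) → s * sumFin f ≡ sumFin (λ i → s * f i)
*-distribˡ-sumFin {zero}  s f = ℤP.*-zeroʳ s
*-distribˡ-sumFin {suc n} s f =
  trans (ℤP.*-distribˡ-+ s (f zero) _) (cong (_+_ (s * f zero)) (*-distribˡ-sumFin s (f ∘ suc)))

*-distribʳ-sumFin : ∀ {n} s (f : Fin n → ℤ) → sumFin f * s ≡ sumFin (λ i → f i * s)
*-distribʳ-sumFin {zero}  s f = ℤP.*-zeroˡ s
*-distribʳ-sumFin {suc n} s f =
  trans (ℤP.*-distribʳ-+ s (f zero) _) (cong (_+_ (f zero * s)) (*-distribʳ-sumFin s (f ∘ suc)))

sumFin-zero : ∀ {n} {f : Fin n → ℤ} → (∀ i → f i ≡ 0ℤ) → sumFin f ≡ 0ℤ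
sumFin-zero {zero}  f≡0 = refl
sumFin-zero {suc n} f≡0 = cong₂ _+_ (f≡0 zero) (sumFin-zero (f≡0 ∘ suc))

sumFin-comm : ∀ {m n} (M : Fin m → Fin n → ℤ) →
              sumFin (λ u → sumFin (M u)) ≡ sumFin (λ v → sumFin (λ u → M u v))
sumFin-comm {zero} {n} M = sym (sumFin-zero {n} (λ _ → refl))
sumFin-comm {suc m} M =
  trans (cong (_+_ (sumFin (M zero))) (sumFin-comm (M ∘ suc)))
        (sym (sumFin-distrib-+ (M zero) (λ v → sumFin (λ u → M (suc u) v))))

sumFin-const : ∀ n c → sumFin {n} (λ _ → c) ≡ + n * c
sumFin-const zero    c = sym (ℤP.*-zeroˡ c)
sumFin-const (suc n) c = trans (cong (_+_ c) (sumFin-const n c)) (collect c (+ n))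
  where
  collect : ∀ c m → c + m * c ≡ (1ℤ + m) * c
  collect = solve-∀

-- Defined through sumFin so that sumBelow (suc m) g unfolds to g 0 + sumBelow m (g ∘ suc).
sumBelow : ℕ → (ℕ → ℤ) → ℤ
sumBelow m g = sumFin {m} (g ∘ toℕ)

sumBelow-cong : ∀ m {f g : ℕ → ℤ} → f ≗ g → sumBelow m f ≡ sumBelow m g
sumBelow-cong m f≗g = sumFin-cong {m} (f≗g ∘ toℕ)

sumL-cong : ∀ {A : Set} {f g : A → ℤ} → f ≗ g → ∀ l → sumL (map f l) ≡ sumL (map g l)
sumL-cong f≗g []      = refl
sumL-cong f≗g (x ∷ l) = cong₂ _+_ (f≗g x) (sumL-cong f≗g l)

sumL-distrib-- : ∀ {A : Set} (f g : A → ℤ) l →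
                 sumL (map (λ x → f x - g x) l) ≡ sumL (map f l) - sumL (map g l)
sumL-distrib-- f g []      = refl
sumL-distrib-- f g (x ∷ l) =
  trans (cong (_+_ (f x - g x)) (sumL-distrib-- f g l)) (interchange (f x) (g x) _ _)
  where
  interchange : ∀ a b c d → a - b + (c - d) ≡ a + c - (b + d)
  interchange = solve-∀

*-distribʳ-sumL : ∀ {A : Set} s (f : A → ℤ) l → sumL (map f l) * s ≡ sumL (map (λ x → f x * s) l)
*-distribʳ-sumL s f []      = ℤP.*-zeroˡ s
*-distribʳ-sumL s f (x ∷ l) =
  trans (ℤP.*-distribʳ-+ s (f x) _) (cong (_+_ (f x * s)) (*-distribʳ-sumL s f l))

sumL-++ : ∀ {A : Set} (f : A → ℤ) l l' → sumL (map f (l ++ l')) ≡ sumL (map f l) + sumL (map f l')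
sumL-++ f []      l' = sym (ℤP.+-identityˡ _)
sumL-++ f (x ∷ l) l' = trans (cong (_+_ (f x)) (sumL-++ f l l')) (sym (ℤP.+-assoc (f x) _ _))

sumL-concatMap-applyUpTo : ∀ {A : Set} (f : A → ℤ) (g : ℕ → List A) (h : ℕ → ℕ) m →
  sumL (map f (concatMap g (applyUpTo h m))) ≡ sumBelow m (λ a → sumL (map f (g (h a))))
sumL-concatMap-applyUpTo f g h zero    = refl
sumL-concatMap-applyUpTo f g h (suc m) =
  trans (sumL-++ f (g (h 0)) _) (cong (_+_ (sumL (map f (g (h 0))))) (sumL-concatMap-applyUpTo f g (h ∘ suc) m))

sumL-box : ∀ {k} (f : Series (suc k)) n → sumL (map f (box n)) ≡
           sumBelow (suc (n zero)) (λ a → sumL (map (λ t → f (a ∷ᶠ t)) (box (n ∘ suc))))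
sumL-box f n =
  trans (sumL-concatMap-applyUpTo f (λ a → map (a ∷ᶠ_) (box (n ∘ suc))) (λ a → a) (suc (n zero)))
        (sumBelow-cong (suc (n zero)) (λ a → cong sumL (sym (map-∘ {g = f} {f = a ∷ᶠ_} (box (n ∘ suc))))))

⊗-congˡ : ∀ {k} {f f' : Series k} (g : Series k) → f ≗ f' → f ⊗ g ≗ f' ⊗ g
⊗-congˡ g f≗f' n = sumL-cong (λ a → cong (_* g (λ i → n i ∸ a i)) (f≗f' a)) (box n)

⊗-congʳ : ∀ {k} (f : Series k) {g g' : Series k} → g ≗ g' → f ⊗ g ≗ f ⊗ g'
⊗-congʳ f g≗g' n = sumL-cong (λ a → cong (f a *_) (g≗g' (λ i → n i ∸ a i))) (box n)

⊗-distribˡ-⊖ : ∀ {k} (f g g' : Series k) → f ⊗ (g ⊖ g') ≗ (f ⊗ g) ⊖ (f ⊗ g')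
⊗-distribˡ-⊖ f g g' n =
  trans (sumL-cong (λ a → x[y-z]≈xy-xz (f a) _ _) (box n)) (sumL-distrib-- _ _ (box n))

Series₁ : Set
Series₁ = ℕ → ℤ

z^ : ℕ → Series₁
z^ t x with t ℕ.≟ x
... | yes _ = 1ℤ
... | no  _ = 0ℤ

z^-≡ : ∀ {t x} → t ≡ x → z^ t x ≡ 1ℤ
z^-≡ {t} {x} t≡x with t ℕ.≟ x
... | yes _   = refl
... | no  t≢x = ⊥-elim (t≢x t≡x)

1-z^ : ℕ → Series₁
1-z^ m x = z^ 0 x - z^ m x

_⋆_ : Series₁ → Series₁ → Series₁
(s ⋆ u) x = sumBelow (suc x) (λ y → s y * u (x ∸ y))

⋆-cong : ∀ {s s' u u' : Series₁} → s ≗ s' → u ≗ u' → s ⋆ u ≗ s' ⋆ u'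
⋆-cong s≗s' u≗u' x = sumBelow-cong (suc x) (λ y → cong₂ _*_ (s≗s' y) (u≗u' (x ∸ y)))

⋆-congˡ : ∀ {s s' : Series₁} (u : Series₁) → s ≗ s' → s ⋆ u ≗ s' ⋆ u
⋆-congˡ u s≗s' = ⋆-cong s≗s' (λ _ → refl)

⋆-distribˡ-- : ∀ (s u v : Series₁) x → (s ⋆ (λ y → u y - v y)) x ≡ (s ⋆ u) x - (s ⋆ v) x
⋆-distribˡ-- s u v x =
  trans (sumBelow-cong (suc x) (λ y → x[y-z]≈xy-xz (s y) (u (x ∸ y)) (v (x ∸ y))))
        (sumFin-distrib-- {suc x} (λ i → s (toℕ i) * u (x ∸ toℕ i)) (λ i → s (toℕ i) * v (x ∸ toℕ i)))

⋆-*ˡ : ∀ c (s u : Series₁) x → ((λ y → c * s y) ⋆ u) x ≡ c * (s ⋆ u) x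
⋆-*ˡ c s u x =
  trans (sumBelow-cong (suc x) (λ y → ℤP.*-assoc c (s y) (u (x ∸ y))))
        (sym (*-distribˡ-sumFin {suc x} c (λ i → s (toℕ i) * u (x ∸ toℕ i))))

⋆-*ʳ : ∀ c (s u : Series₁) x → ((λ y → s y * c) ⋆ u) x ≡ (s ⋆ u) x * c
⋆-*ʳ c s u x =
  trans (sumBelow-cong (suc x) (λ y → swap (s y) c (u (x ∸ y))))
        (sym (*-distribʳ-sumFin {suc x} c (λ i → s (toℕ i) * u (x ∸ toℕ i))))
  where
  swap : ∀ a b d → a * b * d ≡ a * d * b
  swap = solve-∀

z^0-⋆ : ∀ (s : Series₁) → z^ 0 ⋆ s ≗ s
z^0-⋆ s x =
  trans (cong₂ _+_ (ℤP.*-identityˡ (s x))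
                   (sumFin-zero {x} (λ i → ℤP.*-zeroˡ (s (x ∸ suc (toℕ i))))))
        (ℤP.+-identityʳ (s x))

-- Matching on t ≟ suc n also evaluates z^ t (suc n), which is defined by the same test.
⋆-z^ : ∀ (G : Series₁) n t →
       (t ≤ n × (G ⋆ z^ t) n ≡ G (n ∸ t)) ⊎ (n < t × (G ⋆ z^ t) n ≡ 0ℤ)
⋆-z^ G zero zero    = inj₁ (z≤n , trans (ℤP.+-identityʳ _) (ℤP.*-identityʳ (G 0)))
⋆-z^ G zero (suc t) = inj₂ (s≤s z≤n , trans (ℤP.+-identityʳ _) (ℤP.*-zeroʳ (G 0)))
⋆-z^ G (suc n) t with ⋆-z^ (G ∘ suc) n t | t ℕ.≟ suc n
... | inj₁ (1+n≤n , _) | yes refl = ⊥-elim (ℕP.<-irrefl refl 1+n≤n)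
... | inj₁ (t≤n , eq)  | no  t≢1+n = inj₁ (ℕP.m≤n⇒m≤1+n t≤n ,
  trans (cong₂ _+_ (ℤP.*-zeroʳ (G 0)) eq)
        (trans (ℤP.+-identityˡ _) (cong G (sym (ℕP.+-∸-assoc 1 t≤n)))))
... | inj₂ (_ , eq)    | yes refl = inj₁ (ℕP.≤-refl ,
  trans (cong₂ _+_ (ℤP.*-identityʳ (G 0)) eq)
        (trans (ℤP.+-identityʳ (G 0)) (cong G (sym (ℕP.n∸n≡0 n)))))
... | inj₂ (n<t , eq)  | no  t≢1+n = inj₂ (ℕP.≤∧≢⇒< n<t (t≢1+n ∘ sym) ,
  cong₂ _+_ (ℤP.*-zeroʳ (G 0)) eq)

⋆-z^0 : ∀ (G : Series₁) → G ⋆ z^ 0 ≗ G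
⋆-z^0 G n with ⋆-z^ G n 0
... | inj₁ (_ , eq) = eq
... | inj₂ (() , _)

prodSeries : ∀ {k} → (Fin k → Series₁) → Series k
prodSeries {zero}  c m = 1ℤ
prodSeries {suc k} c m = c zero (m zero) * prodSeries (c ∘ suc) (m ∘ suc)

prodSeries-cong : ∀ {k} {c c' : Fin k → Series₁} → (∀ i → c i ≗ c' i) → prodSeries c ≗ prodSeries c'
prodSeries-cong {zero}  c≗c' m = refl
prodSeries-cong {suc k} c≗c' m = cong₂ _*_ (c≗c' zero (m zero)) (prodSeries-cong (c≗c' ∘ suc) (m ∘ suc))

-- Multiplying by a product of one-variable series is an iterated one-variable convolution,
-- performed one coordinate at a time.
convolve : ∀ {k} → (Fin k → Series₁) → Series k → Series k
convolve {zero}  c h n = h (λ ())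
convolve {suc k} c h n = ((λ a → convolve (c ∘ suc) (λ t → h (a ∷ᶠ t)) (n ∘ suc)) ⋆ c zero) (n zero)

⊗-prodSeries : ∀ {k} (c : Fin k → Series₁) (h : Series k) → h ⊗ prodSeries c ≗ convolve c h
⊗-prodSeries {zero}  c h n = trans (ℤP.+-identityʳ _) (ℤP.*-identityʳ _)
⊗-prodSeries {suc k} c h n =
  trans (sumL-box (λ a → h a * prodSeries c (λ i → n i ∸ a i)) n)
        (sumBelow-cong (suc (n zero)) λ a →
          trans (sumL-cong (λ t → rearrange (h (a ∷ᶠ t)) _ _) (box (n ∘ suc)))
          (trans (sym (*-distribʳ-sumL (c zero (n zero ∸ a)) _ (box (n ∘ suc))))
                 (cong (_* c zero (n zero ∸ a)) (⊗-prodSeries (c ∘ suc) (λ t → h (a ∷ᶠ t)) (n ∘ suc)))))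
  where
  rearrange : ∀ x y z → x * (y * z) ≡ x * z * y
  rearrange = solve-∀

convolve-cong : ∀ {k} (c : Fin k → Series₁) {h h' : Series k} → h ≗ h' → convolve c h ≗ convolve c h'
convolve-cong {zero}  c h≗h' n = h≗h' _
convolve-cong {suc k} c h≗h' n =
  ⋆-congˡ (c zero) (λ a → convolve-cong (c ∘ suc) (λ t → h≗h' (a ∷ᶠ t)) (n ∘ suc)) (n zero)

convolve-*ˡ : ∀ {k} (c : Fin k → Series₁) s (h : Series k) n →
              convolve c (λ x → s * h x) n ≡ s * convolve c h n
convolve-*ˡ {zero}  c s h n = refl
convolve-*ˡ {suc k} c s h n =
  trans (⋆-congˡ (c zero) (λ a → convolve-*ˡ (c ∘ suc) s (λ t → h (a ∷ᶠ t)) (n ∘ suc)) (n zero))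
        (⋆-*ˡ s (λ a → convolve (c ∘ suc) (λ t → h (a ∷ᶠ t)) (n ∘ suc)) (c zero) (n zero))

convolve-prodSeries : ∀ {k} (a b : Fin k → Series₁) →
                      convolve b (prodSeries a) ≗ prodSeries (λ i → a i ⋆ b i)
convolve-prodSeries {zero}  a b n = refl
convolve-prodSeries {suc k} a b n =
  trans (⋆-congˡ (b zero) (λ y →
           trans (convolve-*ˡ (b ∘ suc) (a zero y) (prodSeries (a ∘ suc)) (n ∘ suc))
                 (cong (a zero y *_) (convolve-prodSeries (a ∘ suc) (b ∘ suc) (n ∘ suc)))) (n zero))
        (⋆-*ʳ (prodSeries (λ i → a (suc i) ⋆ b (suc i)) (n ∘ suc)) (a zero) (b zero) (n zero))

prodSeries-⊗ : ∀ {k} (a b : Fin k → Series₁) → prodSeries a ⊗ prodSeries b ≗ prodSeries (λ i → a i ⋆ b i)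
prodSeries-⊗ a b n = trans (⊗-prodSeries b (prodSeries a) n) (convolve-prodSeries a b n)

mono-≡ : ∀ {k} (r : Fin k → ℕ) {m} → (∀ i → r i ≡ m i) → mono r m ≡ 1ℤ
mono-≡ r {m} r≡m with all? (λ i → r i ℕ.≟ m i)
... | yes _   = refl
... | no  r≢m = ⊥-elim (r≢m r≡m)

mono-≢ : ∀ {k} (r : Fin k → ℕ) {m} → ¬ (∀ i → r i ≡ m i) → mono r m ≡ 0ℤ
mono-≢ r {m} r≢m with all? (λ i → r i ℕ.≟ m i)
... | yes r≡m = ⊥-elim (r≢m r≡m)
... | no  _   = refl

prodSeries-z^-≡ : ∀ {k} {r m : Fin k → ℕ} → (∀ i → r i ≡ m i) → prodSeries (z^ ∘ r) m ≡ 1ℤ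
prodSeries-z^-≡ {zero}  r≡m = refl
prodSeries-z^-≡ {suc k} r≡m = cong₂ _*_ (z^-≡ (r≡m zero)) (prodSeries-z^-≡ (r≡m ∘ suc))

prodSeries-z^-≢ : ∀ {k} {r m : Fin k → ℕ} → ¬ (∀ i → r i ≡ m i) → prodSeries (z^ ∘ r) m ≡ 0ℤ
prodSeries-z^-≢ {zero}          r≢m = ⊥-elim (r≢m (λ ()))
prodSeries-z^-≢ {suc k} {r} {m} r≢m with r zero ℕ.≟ m zero
... | no  _    = ℤP.*-zeroˡ (prodSeries (z^ ∘ r ∘ suc) (m ∘ suc))
... | yes r₀≡m₀ = trans (ℤP.*-identityˡ _) (prodSeries-z^-≢ λ r≡m → r≢m λ where
                    zero    → r₀≡m₀
                    (suc i) → r≡m i)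

mono-prodSeries : ∀ {k} (r : Fin k → ℕ) → mono r ≗ prodSeries (z^ ∘ r)
mono-prodSeries r m with all? (λ i → r i ℕ.≟ m i)
... | yes r≡m = sym (prodSeries-z^-≡ r≡m)
... | no  r≢m = sym (prodSeries-z^-≢ r≢m)

oneMinusAt : ∀ {k} → Fin k → ℕ → Fin k → Series₁
oneMinusAt t m i with i Fin.≟ t
... | yes _ = 1-z^ m
... | no  _ = z^ 0

oneMinusAt-≡ : ∀ {k} (t : Fin k) m → oneMinusAt t m t ≗ 1-z^ m
oneMinusAt-≡ t m x with t Fin.≟ t
... | yes _   = refl
... | no  t≢t = ⊥-elim (t≢t refl)

oneMinusAt-≢ : ∀ {k} {i t : Fin k} m → i ≢ t → oneMinusAt t m i ≗ z^ 0
oneMinusAt-≢ {i = i} {t} m i≢t x with i Fin.≟ t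
... | yes i≡t = ⊥-elim (i≢t i≡t)
... | no  _   = refl

expo-≡ : ∀ {k} (t : Fin k) m → expo t m t ≡ m
expo-≡ t m with t Fin.≟ t
... | yes _   = refl
... | no  t≢t = ⊥-elim (t≢t refl)

expo-≢ : ∀ {k} {t i : Fin k} m → t ≢ i → expo t m i ≡ 0
expo-≢ {t = t} {i} m t≢i with t Fin.≟ i
... | yes t≡i = ⊥-elim (t≢i t≡i)
... | no  _   = refl

prodSeries-⊖-at : ∀ {k} (t : Fin k) (a b e : Fin k → Series₁) →
  (∀ i → i ≢ t → a i ≗ e i) → (∀ i → i ≢ t → b i ≗ e i) → (∀ x → e t x ≡ a t x - b t x) →
  ∀ m → prodSeries a m - prodSeries b m ≡ prodSeries e m
prodSeries-⊖-at zero a b e a≗e b≗e eₜ m =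
  begin
    a zero m₀ * prodSeries (a ∘ suc) (m ∘ suc) - b zero m₀ * prodSeries (b ∘ suc) (m ∘ suc)
  ≡⟨ cong₂ (λ u v → a zero m₀ * u - b zero m₀ * v)
           (prodSeries-cong (λ i → a≗e (suc i) (λ ())) (m ∘ suc))
           (prodSeries-cong (λ i → b≗e (suc i) (λ ())) (m ∘ suc)) ⟩
    a zero m₀ * rest - b zero m₀ * rest
  ≡⟨ sym ([y-z]x≈yx-zx rest (a zero m₀) (b zero m₀)) ⟩
    (a zero m₀ - b zero m₀) * rest
  ≡⟨ cong (_* rest) (sym (eₜ m₀)) ⟩
    e zero m₀ * rest
  ∎
  where
  open ≡-Reasoning
  m₀ = m zero
  rest = prodSeries (e ∘ suc) (m ∘ suc)
prodSeries-⊖-at (suc t) a b e a≗e b≗e eₜ m =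
  begin
    a zero m₀ * prodSeries (a ∘ suc) (m ∘ suc) - b zero m₀ * prodSeries (b ∘ suc) (m ∘ suc)
  ≡⟨ cong₂ (λ u v → u * prodSeries (a ∘ suc) (m ∘ suc) - v * prodSeries (b ∘ suc) (m ∘ suc))
           (a≗e zero (λ ()) m₀) (b≗e zero (λ ()) m₀) ⟩
    e zero m₀ * prodSeries (a ∘ suc) (m ∘ suc) - e zero m₀ * prodSeries (b ∘ suc) (m ∘ suc)
  ≡⟨ sym (x[y-z]≈xy-xz (e zero m₀) _ _) ⟩
    e zero m₀ * (prodSeries (a ∘ suc) (m ∘ suc) - prodSeries (b ∘ suc) (m ∘ suc))
  ≡⟨ cong (e zero m₀ *_) (prodSeries-⊖-at t (a ∘ suc) (b ∘ suc) (e ∘ suc)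
           (λ i i≢t → a≗e (suc i) (i≢t ∘ FinP.suc-injective))
           (λ i i≢t → b≗e (suc i) (i≢t ∘ FinP.suc-injective)) eₜ (m ∘ suc)) ⟩
    e zero m₀ * prodSeries (e ∘ suc) (m ∘ suc)
  ∎
  where
  open ≡-Reasoning
  m₀ = m zero

one⊖mono-expo : ∀ {k} (t : Fin k) m → one ⊖ mono (expo t m) ≗ prodSeries (oneMinusAt t m)
one⊖mono-expo t m x =
  trans (cong₂ _-_ (mono-prodSeries (λ _ → 0) x) (mono-prodSeries (expo t m) x))
        (prodSeries-⊖-at t (λ _ → z^ 0) (z^ ∘ expo t m) (oneMinusAt t m)
          (λ i i≢t y → sym (oneMinusAt-≢ m i≢t y))
          (λ i i≢t y → trans (cong (λ e → z^ e y) (expo-≢ m (i≢t ∘ sym))) (sym (oneMinusAt-≢ m i≢t y)))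
          (λ y → trans (oneMinusAt-≡ t m y) (cong (λ e → z^ 0 y - z^ e y) (sym (expo-≡ t m))))
          x)

⋆-product : ∀ j → (Fin j → Series₁) → Series₁
⋆-product zero    s = z^ 0
⋆-product (suc j) s = s zero ⋆ ⋆-product j (s ∘ suc)

prodFin-prodSeries : ∀ {k} j (G : Fin j → Series k) (e : Fin j → Fin k → Series₁) →
  (∀ t → G t ≗ prodSeries (e t)) → prodFin j G ≗ prodSeries (λ i → ⋆-product j (λ t → e t i))
prodFin-prodSeries zero    G e G≗e = mono-prodSeries (λ _ → 0)
prodFin-prodSeries (suc j) G e G≗e m =
  trans (⊗-congˡ (prodFin j (G ∘ suc)) (G≗e zero) m)
  (trans (⊗-congʳ (prodSeries (e zero)) (prodFin-prodSeries j (G ∘ suc) (e ∘ suc) (G≗e ∘ suc)) m)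
         (prodSeries-⊗ (e zero) (λ i → ⋆-product j (λ t → e (suc t) i)) m))

⋆-product-z^0 : ∀ j (s : Fin j → Series₁) → (∀ t → s t ≗ z^ 0) → ⋆-product j s ≗ z^ 0
⋆-product-z^0 zero    s s≗1 = λ _ → refl
⋆-product-z^0 (suc j) s s≗1 x =
  trans (⋆-cong (s≗1 zero) (⋆-product-z^0 j (s ∘ suc) (s≗1 ∘ suc)) x) (z^0-⋆ (z^ 0) x)

⋆-product-single : ∀ j (s : Fin j → Series₁) t₀ → (∀ t → t ≢ t₀ → s t ≗ z^ 0) →
                   ⋆-product j s ≗ s t₀
⋆-product-single (suc j) s zero s≗1 x =
  trans (⋆-cong {s = s zero} (λ _ → refl) (⋆-product-z^0 j (s ∘ suc) (λ t → s≗1 (suc t) (λ ()))) x)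
        (⋆-z^0 (s zero) x)
⋆-product-single (suc j) s (suc t₀) s≗1 x =
  trans (⋆-congˡ (⋆-product j (s ∘ suc)) (s≗1 zero (λ ())) x)
  (trans (z^0-⋆ (⋆-product j (s ∘ suc)) x)
         (⋆-product-single j (s ∘ suc) t₀ (λ t t≢t₀ → s≗1 (suc t) (t≢t₀ ∘ FinP.suc-injective)) x))

denominator-prodSeries : ∀ {k} (μ : Fin k → ℕ) → denominator μ ≗ prodSeries (λ i → 1-z^ (μ i))
denominator-prodSeries {k} μ m =
  trans (prodFin-prodSeries k _ (λ t → oneMinusAt t (μ t)) (λ t → one⊖mono-expo t (μ t)) m)
        (prodSeries-cong (λ i x →
          trans (⋆-product-single k (λ t → oneMinusAt t (μ t) i) i
                                  (λ t t≢i → oneMinusAt-≢ (μ t) (t≢i ∘ sym)) x)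
                (oneMinusAt-≡ i (μ i) x)) m)

Extensional : ∀ {k} → Series k → Set
Extensional h = ∀ {x y} → x ≗ y → h x ≡ h y

convolve-z^ : ∀ {k} (t : Fin k → ℕ) {H : Series k} → Extensional H → ∀ n →
  (Pointwise _≤_ t n × convolve (z^ ∘ t) H n ≡ H (λ i → n i ∸ t i)) ⊎
  (¬ Pointwise _≤_ t n × convolve (z^ ∘ t) H n ≡ 0ℤ)
convolve-z^ {zero}  t ext n = inj₁ ((λ ()) , ext (λ ()))
convolve-z^ {suc k} t {H} ext n
  with ⋆-z^ (λ a → convolve (z^ ∘ t ∘ suc) (λ s → H (a ∷ᶠ s)) (n ∘ suc)) (n zero) (t zero)
... | inj₂ (n₀<t₀ , eq) = inj₂ ((λ t≤n → ℕP.<⇒≱ n₀<t₀ (t≤n zero)) , eq)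
... | inj₁ (t₀≤n₀ , eq)
  with convolve-z^ (t ∘ suc) {λ s → H ((n zero ∸ t zero) ∷ᶠ s)}
                   (λ x≗y → ext λ { zero → refl ; (suc i) → x≗y i }) (n ∘ suc)
...   | inj₁ (t≤n , eq′) = inj₁ ((λ { zero → t₀≤n₀ ; (suc i) → t≤n i }) ,
                                 trans eq (trans eq′ (ext λ { zero → refl ; (suc i) → refl })))
...   | inj₂ (t≰n , eq′) = inj₂ ((λ t≤n → t≰n (t≤n ∘ suc)) , trans eq eq′)

⊗-mono : ∀ {k} (t : Fin k → ℕ) {H : Series k} → Extensional H → ∀ n →
  (Pointwise _≤_ t n × (H ⊗ mono t) n ≡ H (λ i → n i ∸ t i)) ⊎
  (¬ Pointwise _≤_ t n × (H ⊗ mono t) n ≡ 0ℤ)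
⊗-mono t {H} ext n = Sum.map (Product.map₂ (trans H⊗mono≡)) (Product.map₂ (trans H⊗mono≡))
                             (convolve-z^ t ext n)
  where
  H⊗mono≡ : (H ⊗ mono t) n ≡ convolve (z^ ∘ t) H n
  H⊗mono≡ = trans (⊗-congʳ H (mono-prodSeries t) n) (⊗-prodSeries (z^ ∘ t) H n)

⊗-one : ∀ {k} {H : Series k} → Extensional H → H ⊗ one ≗ H
⊗-one ext n with ⊗-mono (λ _ → 0) ext n
... | inj₁ (_ , eq)  = trans eq (ext (λ _ → refl))
... | inj₂ (0≰n , _) = ⊥-elim (0≰n (λ _ → z≤n))

ShiftedByPeriods : ∀ {k} → (Fin k → ℕ) → (Fin k → ℕ) → (Fin k → ℕ) → Set
ShiftedByPeriods μ x y = ∀ i → x i ≡ y i ⊎ x i ≡ μ i ℕ.+ y i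

Periodic : ∀ {k} → (Fin k → ℕ) → Series k → Set
Periodic μ h = ∀ {x y} → ShiftedByPeriods μ x y → h x ≡ h y

-- In the first coordinate the factor 1 - z^{μ₀} turns the coefficient G n₀ into G n₀ - G (n₀ - μ₀)
-- when μ₀ ≤ n₀, and periodicity makes this vanish.
convolve-1-z^-periodic : ∀ {k} (μ : Fin k → ℕ) {h : Series k} → Periodic μ h → ∀ n →
  (Pointwise _<_ n μ × convolve (1-z^ ∘ μ) h n ≡ h n) ⊎
  (¬ Pointwise _<_ n μ × convolve (1-z^ ∘ μ) h n ≡ 0ℤ)
convolve-1-z^-periodic {zero}  μ per n = inj₁ ((λ ()) , per (λ ()))
convolve-1-z^-periodic {suc k} μ {h} per n = result
  where
  n₀ = n zero
  μ₀ = μ zero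
  G : Series₁
  G a = convolve (1-z^ ∘ μ ∘ suc) (λ t → h (a ∷ᶠ t)) (n ∘ suc)
  value : convolve (1-z^ ∘ μ) h n ≡ G n₀ - (G ⋆ z^ μ₀) n₀
  value = trans (⋆-distribˡ-- G (z^ 0) (z^ μ₀) n₀) (cong (_- (G ⋆ z^ μ₀) n₀) (⋆-z^0 G n₀))
  slice-periodic : Periodic (μ ∘ suc) (λ t → h (n₀ ∷ᶠ t))
  slice-periodic shift = per λ { zero → inj₁ refl ; (suc i) → shift i }
  result : (Pointwise _<_ n μ × convolve (1-z^ ∘ μ) h n ≡ h n) ⊎
           (¬ Pointwise _<_ n μ × convolve (1-z^ ∘ μ) h n ≡ 0ℤ)
  result with ⋆-z^ G n₀ μ₀
  ... | inj₁ (μ₀≤n₀ , eq) = inj₂ ((λ n<μ → ℕP.<⇒≱ (n<μ zero) μ₀≤n₀) ,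
          trans value (trans (cong₂ _-_ G-shift eq) (ℤP.+-inverseʳ (G (n₀ ∸ μ₀)))))
    where
    G-shift : G n₀ ≡ G (n₀ ∸ μ₀)
    G-shift = convolve-cong (1-z^ ∘ μ ∘ suc)
      (λ t → per λ { zero → inj₂ (sym (ℕP.m+[n∸m]≡n μ₀≤n₀)) ; (suc i) → inj₁ refl }) (n ∘ suc)
  ... | inj₂ (n₀<μ₀ , eq) with convolve-1-z^-periodic (μ ∘ suc) slice-periodic (n ∘ suc)
  ...   | inj₁ (n<μ , eq′) = inj₁ ((λ { zero → n₀<μ₀ ; (suc i) → n<μ i }) ,
          trans value (trans (cong (_-_ (G n₀)) eq)
                (trans (ℤP.+-identityʳ (G n₀))
                (trans eq′ (per λ { zero → inj₁ refl ; (suc i) → inj₁ refl })))))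
  ...   | inj₂ (n≮μ , eq′) = inj₂ ((λ n<μ → n≮μ (n<μ ∘ suc)) ,
          trans value (trans (cong (_-_ (G n₀)) eq) (trans (ℤP.+-identityʳ (G n₀)) eq′)))

⊗-denominator-periodic : ∀ {k} (μ : Fin k → ℕ) {h : Series k} → Periodic μ h → ∀ n →
  (Pointwise _<_ n μ × (h ⊗ denominator μ) n ≡ h n) ⊎
  (¬ Pointwise _<_ n μ × (h ⊗ denominator μ) n ≡ 0ℤ)
⊗-denominator-periodic μ {h} per n =
  Sum.map (Product.map₂ (trans h⊗den≡)) (Product.map₂ (trans h⊗den≡)) (convolve-1-z^-periodic μ per n)
  where
  h⊗den≡ : (h ⊗ denominator μ) n ≡ convolve (1-z^ ∘ μ) h n
  h⊗den≡ = trans (⊗-congʳ h (denominator-prodSeries μ) n) (⊗-prodSeries (1-z^ ∘ μ) h n)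

pt-≢ : ∀ {V} {v u : Fin V} → v ≢ u → pt v u ≡ 0ℤ
pt-≢ {v = v} {u} v≢u with v Fin.≟ u
... | yes v≡u = ⊥-elim (v≢u v≡u)
... | no  _   = refl

pt-≡ : ∀ {V} {v u : Fin V} → v ≡ u → pt v u ≡ 1ℤ
pt-≡ {v = v} {u} v≡u with v Fin.≟ u
... | yes _   = refl
... | no  v≢u = ⊥-elim (v≢u v≡u)

pt-comm : ∀ {V} (v u : Fin V) → pt v u ≡ pt u v
pt-comm v u with v Fin.≟ u
... | yes v≡u = sym (pt-≡ (sym v≡u))
... | no  v≢u = sym (pt-≢ (v≢u ∘ sym))

sumFin-*-pt : ∀ {V} (v : Fin V) (g : Fin V → ℤ) → sumFin (λ u → g u * pt v u) ≡ g v
sumFin-*-pt {suc V} zero g =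
  trans (cong₂ _+_ (ℤP.*-identityʳ (g zero)) (sumFin-zero (λ u → ℤP.*-zeroʳ (g (suc u)))))
        (ℤP.+-identityʳ (g zero))
sumFin-*-pt {suc V} (suc v) g =
  trans (cong₂ _+_ (ℤP.*-zeroʳ (g zero))
                   (trans (sumFin-cong (λ u → cong (g (suc u) *_) (pt-suc u))) (sumFin-*-pt v (g ∘ suc))))
        (ℤP.+-identityˡ (g (suc v)))
  where
  pt-suc : ∀ u → pt (suc v) (suc u) ≡ pt v u
  pt-suc u with v Fin.≟ u
  ... | yes _ = refl
  ... | no  _ = refl

deg-pt : ∀ {V} (v : Fin V) → deg (pt v) ≡ 1ℤ
deg-pt v = trans (sumFin-cong (λ u → sym (ℤP.*-identityˡ (pt v u))))
                 (sumFin-*-pt v (λ _ → 1ℤ))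

IsSymmetric : ∀ {V} → Mult V → Set
IsSymmetric A = ∀ u v → A u v ≡ A v u

deg-divisor : ∀ {V} {A : Mult V} → IsSymmetric A → ∀ f → deg (divisor A f) ≡ 0ℤ
deg-divisor {A = A} A-sym f =
  begin
    sumFin (λ u → sumFin (λ v → + A u v * (f u - f v)))
  ≡⟨ sumFin-cong (λ u → trans (sumFin-cong (λ v → x[y-z]≈xy-xz (+ A u v) (f u) (f v)))
                             (sumFin-distrib-- (λ v → + A u v * f u) (λ v → + A u v * f v))) ⟩
    sumFin (λ u → outflow u - inflow u)
  ≡⟨ sumFin-distrib-- outflow inflow ⟩
    sumFin outflow - sumFin inflow
  ≡⟨ cong (_-_ (sumFin outflow)) inflow≡outflow ⟩
    sumFin outflow - sumFin outflow
  ≡⟨ ℤP.+-inverseʳ (sumFin outflow) ⟩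
    0ℤ
  ∎
  where
  open ≡-Reasoning
  outflow inflow : _ → ℤ
  outflow u = sumFin (λ v → + A u v * f u)
  inflow  u = sumFin (λ v → + A u v * f v)
  inflow≡outflow : sumFin inflow ≡ sumFin outflow
  inflow≡outflow = trans (sumFin-comm (λ u v → + A u v * f v))
                         (sumFin-cong λ v → sumFin-cong λ u → cong (λ a → + a * f v) (A-sym u v))

divisor-+ : ∀ {V} (A : Mult V) (f g : Fin V → ℤ) u →
            divisor A (λ v → f v + g v) u ≡ divisor A f u + divisor A g u
divisor-+ A f g u =
  trans (sumFin-cong (λ v → rearrange (+ A u v) (f u) (g u) (f v) (g v)))
        (sumFin-distrib-+ (λ v → + A u v * (f u - f v)) (λ v → + A u v * (g u - g v)))
  where
  rearrange : ∀ a b c d e → a * (b + c - (d + e)) ≡ a * (b - d) + a * (c - e)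
  rearrange = solve-∀

divisor-neg : ∀ {V} (A : Mult V) (f : Fin V → ℤ) u → divisor A (λ v → - f v) u ≡ - divisor A f u
divisor-neg A f u =
  trans (sumFin-cong (λ v → rearrange (+ A u v) (f u) (f v))) (sumFin-neg (λ v → + A u v * (f u - f v)))
  where
  rearrange : ∀ a b c → a * (- b - - c) ≡ - (a * (b - c))
  rearrange = solve-∀

divisor-sum : ∀ {V k} (A : Mult V) (c : Fin k → ℤ) (F : Fin k → Fin V → ℤ) u →
  divisor A (λ v → sumFin (λ i → c i * F i v)) u ≡ sumFin (λ i → c i * divisor A (F i) u)
divisor-sum A c F u =
  begin
    sumFin (λ v → + A u v * (sumFin (λ i → c i * F i u) - sumFin (λ i → c i * F i v)))
  ≡⟨ sumFin-cong (λ v → trans (cong (+ A u v *_)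
                                    (sym (sumFin-distrib-- (λ i → c i * F i u) (λ i → c i * F i v))))
                              (*-distribˡ-sumFin (+ A u v) (λ i → c i * F i u - c i * F i v))) ⟩
    sumFin (λ v → sumFin (λ i → + A u v * (c i * F i u - c i * F i v)))
  ≡⟨ sumFin-comm (λ v i → + A u v * (c i * F i u - c i * F i v)) ⟩
    sumFin (λ i → sumFin (λ v → + A u v * (c i * F i u - c i * F i v)))
  ≡⟨ sumFin-cong (λ i → trans (sumFin-cong (λ v → rearrange (+ A u v) (c i) (F i u) (F i v)))
                              (sym (*-distribˡ-sumFin (c i) (λ v → + A u v * (F i u - F i v))))) ⟩
    sumFin (λ i → c i * divisor A (F i) u)
  ∎
  where
  open ≡-Reasoning
  rearrange : ∀ a b c d → a * (b * c - b * d) ≡ b * (a * (c - d))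
  rearrange = solve-∀

∼-sym : ∀ {V} {A : Mult V} {D D' : Div V} → D ∼⟨ A ⟩ D' → D' ∼⟨ A ⟩ D
∼-sym {A = A} {D} {D'} (f , D-D'≡divf) = (λ v → - f v) , λ u →
  trans (flip (D u) (D' u)) (trans (cong -_ (D-D'≡divf u)) (sym (divisor-neg A f u)))
  where
  flip : ∀ a b → b - a ≡ - (a - b)
  flip = solve-∀

∼-trans : ∀ {V} {A : Mult V} {D D' D'' : Div V} → D ∼⟨ A ⟩ D' → D' ∼⟨ A ⟩ D'' → D ∼⟨ A ⟩ D''
∼-trans {A = A} {D} {D'} {D''} (f , D-D'≡divf) (g , D'-D''≡divg) = (λ v → f v + g v) , λ u →
  trans (telescope (D u) (D' u) (D'' u))
        (trans (cong₂ _+_ (D-D'≡divf u) (D'-D''≡divg u)) (sym (divisor-+ A f g u)))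
  where
  telescope : ∀ a b c → a - c ≡ (a - b) + (b - c)
  telescope = solve-∀

∼-deg : ∀ {V} {A : Mult V} {D D' : Div V} → IsSymmetric A → D ∼⟨ A ⟩ D' → deg D ≡ deg D'
∼-deg {D = D} {D'} A-sym (f , D-D'≡divf) =
  ℤP.i-j≡0⇒i≡j (deg D) (deg D')
    (trans (sym (sumFin-distrib-- D D')) (trans (sumFin-cong D-D'≡divf) (deg-divisor A-sym f)))

deg-Dᵢ : ∀ {k} (i : Fin k) → deg (Dᵢ i) ≡ 0ℤ
deg-Dᵢ {k} i = trans (sumFin-distrib-- (pt (inject₁ i)) (pt (fromℕ k)))
                     (cong₂ _-_ (deg-pt (inject₁ i)) (deg-pt (fromℕ k)))

deg-combo : ∀ {k} (n : Fin k → ℕ) → deg (combo n) ≡ 0ℤ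
deg-combo n =
  trans (sumFin-comm (λ u i → + n i * Dᵢ i u))
        (sumFin-zero λ i → trans (sym (*-distribˡ-sumFin (+ n i) (Dᵢ i)))
                                 (trans (cong (+ n i *_) (deg-Dᵢ i)) (ℤP.*-zeroʳ (+ n i))))

shiftCoefficient : ∀ {a b m : ℕ} → a ≡ b ⊎ a ≡ m ℕ.+ b → ℤ
shiftCoefficient (inj₁ _) = 0ℤ
shiftCoefficient (inj₂ _) = 1ℤ

shiftCoefficient-spec : ∀ {a b m : ℕ} (p : a ≡ b ⊎ a ≡ m ℕ.+ b) d →
                        + a * d - + b * d ≡ shiftCoefficient p * (+ m * d - 0ℤ)
shiftCoefficient-spec {a} {m = m} (inj₁ refl) d = cancel (+ a * d) (+ m * d - 0ℤ)
  where
  cancel : ∀ x y → x - x ≡ 0ℤ * y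
  cancel = solve-∀
shiftCoefficient-spec {b = b} {m} (inj₂ refl) d =
  trans (cong (λ a → a * d - + b * d) (ℤP.pos-+ m b)) (cancel (+ m) (+ b) d)
  where
  cancel : ∀ x y d → (x + y) * d - y * d ≡ 1ℤ * (x * d - 0ℤ)
  cancel = solve-∀

combo-∼-shift : ∀ {k} {A : Mult (suc k)} {μ : Fin k → ℕ} → (∀ i → (μ i ·ᴰ Dᵢ i) ∼⟨ A ⟩ zeroDiv) →
                ∀ {x y} → ShiftedByPeriods μ x y → combo x ∼⟨ A ⟩ combo y
combo-∼-shift {k} {A} {μ} μDᵢ∼0 {x} {y} shift = g , λ u →
  begin
    combo x u - combo y u
  ≡⟨ sym (sumFin-distrib-- (λ i → + x i * Dᵢ i u) (λ i → + y i * Dᵢ i u)) ⟩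
    sumFin (λ i → + x i * Dᵢ i u - + y i * Dᵢ i u)
  ≡⟨ sumFin-cong (λ i → trans (shiftCoefficient-spec (shift i) (Dᵢ i u))
                              (cong (ε i *_) (proj₂ (μDᵢ∼0 i) u))) ⟩
    sumFin (λ i → ε i * divisor A (proj₁ (μDᵢ∼0 i)) u)
  ≡⟨ sym (divisor-sum A ε (λ i → proj₁ (μDᵢ∼0 i)) u) ⟩
    divisor A g u
  ∎
  where
  open ≡-Reasoning
  ε : Fin k → ℤ
  ε i = shiftCoefficient (shift i)
  g : Fin (suc k) → ℤ
  g v = sumFin (λ i → ε i * proj₁ (μDᵢ∼0 i) v)

Kernel : ∀ {k} → Mult (suc k) → (Fin k → ℕ) → Set
Kernel A x = combo x ∼⟨ A ⟩ zeroDiv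

kernel-shift : ∀ {k} {A : Mult (suc k)} {μ : Fin k → ℕ} → (∀ i → (μ i ·ᴰ Dᵢ i) ∼⟨ A ⟩ zeroDiv) →
               ∀ {x y} → ShiftedByPeriods μ x y → Kernel A x ⇔ Kernel A y
kernel-shift {A = A} {μ} μDᵢ∼0 {x} {y} shift =
  mk⇔ (∼-trans {A = A} {combo y} {combo x} {zeroDiv} (∼-sym {A = A} {combo x} {combo y} x∼y))
      (∼-trans {A = A} {combo x} {combo y} {zeroDiv} x∼y)
  where
  x∼y : combo x ∼⟨ A ⟩ combo y
  x∼y = combo-∼-shift {A = A} {μ} μDᵢ∼0 shift

effective-deg-nonneg : ∀ {V} {D : Div V} → Effective D → ℤ._≤_ 0ℤ (deg D)
effective-deg-nonneg {zero}  _   = ℤ.+≤+ z≤n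
effective-deg-nonneg {suc V} {D} eff = ℤP.+-mono-≤ (eff zero) (effective-deg-nonneg {D = D ∘ suc} (eff ∘ suc))

nonneg-+-zero : ∀ {a b} → ℤ._≤_ 0ℤ a → ℤ._≤_ 0ℤ b → a + b ≡ 0ℤ → a ≡ 0ℤ × b ≡ 0ℤ
nonneg-+-zero {+ m} {+ n} _ _ m+n≡0 =
  cong +_ (ℕP.m+n≡0⇒m≡0 m (ℤP.+-injective m+n≡0)) , cong +_ (ℕP.m+n≡0⇒n≡0 m (ℤP.+-injective m+n≡0))

effective-deg-zero : ∀ {V} {D : Div V} → Effective D → deg D ≡ 0ℤ → ∀ u → D u ≡ 0ℤ
effective-deg-zero {suc V} {D} eff deg≡0 = λ where
    zero    → proj₁ parts
    (suc u) → effective-deg-zero {D = D ∘ suc} (eff ∘ suc) (proj₂ parts) u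
  where
  parts = nonneg-+-zero (eff zero) (effective-deg-nonneg {D = D ∘ suc} (eff ∘ suc)) deg≡0

·ᴰ-pt-effective : ∀ {V} m (v : Fin V) → Effective (m ·ᴰ pt v)
·ᴰ-pt-effective m v u with v Fin.≟ u
... | yes _ = subst (ℤ._≤_ 0ℤ) (ℤP.pos-* m 1) (ℤ.+≤+ z≤n)
... | no  _ = subst (ℤ._≤_ 0ℤ) (ℤP.pos-* m 0) (ℤ.+≤+ z≤n)

deg-·ᴰ-pt : ∀ {V} m (v : Fin V) → deg (m ·ᴰ pt v) ≡ + m
deg-·ᴰ-pt {V} m v =
  trans (sym (*-distribˡ-sumFin {V} (+ m) (pt v))) (trans (cong (+ m *_) (deg-pt v)) (ℤP.*-identityʳ (+ m)))

rankAtLeast-≤-deg : ∀ {V} {A : Mult (suc V)} {D : Div (suc V)} → IsSymmetric A →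
                    ∀ {m} → RankAtLeast A D m → ℤ._≤_ (+ m) (deg D)
rankAtLeast-≤-deg {V} {A} {D} A-sym {m} rk
  with rk (m ·ᴰ pt zero) (·ᴰ-pt-effective m zero) (deg-·ᴰ-pt m (zero {V}))
... | D' , D'-eff , D-E∼D' =
  ℤP.0≤i-j⇒j≤i (subst (ℤ._≤_ 0ℤ) deg-D' (effective-deg-nonneg {D = D'} D'-eff))
  where
  deg-D' : deg D' ≡ deg D - + m
  deg-D' = trans (sym (∼-deg {D = D -ᴰ (m ·ᴰ pt zero)} {D'} A-sym D-E∼D'))
                 (trans (sumFin-distrib-- D (m ·ᴰ pt zero)) (cong (_-_ (deg D)) (deg-·ᴰ-pt m (zero {V}))))

linEqEff-deg-zero : ∀ {V} {A : Mult V} {D : Div V} → IsSymmetric A → deg D ≡ 0ℤ →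
                    LinEqEff A D → D ∼⟨ A ⟩ zeroDiv
linEqEff-deg-zero {D = D} A-sym deg≡0 (D' , D'-eff , f , D-D'≡divf) =
  f , λ u → trans (cong (_-_ (D u)) (sym (D'≡0 u))) (D-D'≡divf u)
  where
  D'≡0 : ∀ u → D' u ≡ 0ℤ
  D'≡0 = effective-deg-zero {D = D'} D'-eff (trans (sym (∼-deg {D = D} {D'} A-sym (f , D-D'≡divf))) deg≡0)

rank-deg-zero : ∀ {V} {A : Mult (suc V)} {D : Div (suc V)} {r} → IsSymmetric A → deg D ≡ 0ℤ →
  IsRank A D r → (D ∼⟨ A ⟩ zeroDiv × r + 1ℤ ≡ 1ℤ) ⊎ (¬ D ∼⟨ A ⟩ zeroDiv × r + 1ℤ ≡ 0ℤ)
rank-deg-zero A-sym deg≡0 (inj₁ (¬D≥0 , refl)) =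
  inj₂ ((λ D∼0 → ¬D≥0 (zeroDiv , (λ _ → ℤ.+≤+ z≤n) , D∼0)) , refl)
rank-deg-zero {A = A} {D} A-sym deg≡0 (inj₂ (D≥0 , m , refl , rk , _)) =
  inj₁ (linEqEff-deg-zero {A = A} {D} A-sym deg≡0 D≥0 , cong (λ m → + m + 1ℤ) m≡0)
  where
  m≡0 : m ≡ 0
  m≡0 = ℕP.n≤0⇒n≡0 (ℤP.drop‿+≤+ (subst (ℤ._≤_ (+ m)) deg≡0 (rankAtLeast-≤-deg {A = A} {D} A-sym rk)))

indicator-≡ : ∀ {k} {P Q : (Fin k → ℕ) → Set} {h h' : Series k} →
              IsIndicatorSeries P h → IsIndicatorSeries Q h' → ∀ {x y} → P x ⇔ Q y → h x ≡ h' y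
indicator-≡ isP isQ {x} {y} Px⇔Qy with isP x | isQ y
... | inj₁ (_ , hx≡1)  | inj₁ (_ , h'y≡1) = trans hx≡1 (sym h'y≡1)
... | inj₁ (px , _)    | inj₂ (¬qy , _)   = ⊥-elim (¬qy (Equivalence.to Px⇔Qy px))
... | inj₂ (¬px , _)   | inj₁ (qy , _)    = ⊥-elim (¬px (Equivalence.from Px⇔Qy qy))
... | inj₂ (_ , hx≡0)  | inj₂ (_ , h'y≡0) = trans hx≡0 (sym h'y≡0)

indicator-unique : ∀ {k} {P : (Fin k → ℕ) → Set} {h h' : Series k} →
                   IsIndicatorSeries P h → IsIndicatorSeries P h' → h ≗ h'
indicator-unique isP isP' x = indicator-≡ isP isP' (mk⇔ id id)

indicator-⇔ : ∀ {k} {P Q : (Fin k → ℕ) → Set} {h : Series k} →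
              IsIndicatorSeries P h → (∀ x → P x ⇔ Q x) → IsIndicatorSeries Q h
indicator-⇔ isP P⇔Q x =
  Sum.map (Product.map₁ (Equivalence.to (P⇔Q x)))
          (Product.map₁ (λ ¬px → ¬px ∘ Equivalence.from (P⇔Q x))) (isP x)

⊗-denominator-indicator : ∀ {k} (μ : Fin k → ℕ) {P : (Fin k → ℕ) → Set} {h : Series k} →
  IsIndicatorSeries P h → Periodic μ h → IsIndicatorSeries (λ x → Pointwise _<_ x μ × P x) (h ⊗ denominator μ)
⊗-denominator-indicator μ isP per n with ⊗-denominator-periodic μ per n | isP n
... | inj₁ (n<μ , eq) | inj₁ (pn , hn≡1)  = inj₁ ((n<μ , pn) , trans eq hn≡1)
... | inj₁ (_ , eq)   | inj₂ (¬pn , hn≡0) = inj₂ (¬pn ∘ proj₂ , trans eq hn≡0)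
... | inj₂ (n≮μ , eq) | _                 = inj₂ (n≮μ ∘ proj₁ , eq)

poincare⊗denominator-indicator : ∀ {k} {A : Mult (suc k)} → IsSymmetric A →
  {μ : Fin k → ℕ} → (∀ i → (μ i ·ᴰ Dᵢ i) ∼⟨ A ⟩ zeroDiv) →
  {ρ : (Fin k → ℕ) → ℤ} → (∀ n → IsRank A (combo n) (ρ n)) →
  IsIndicatorSeries (InB A μ) (poincare ρ ⊗ denominator μ)
poincare⊗denominator-indicator {A = A} A-sym {μ} μDᵢ∼0 {ρ} rk =
  ⊗-denominator-indicator μ {h = poincare ρ} poincare-kernel
    (λ shift → indicator-≡ poincare-kernel poincare-kernel (kernel-shift {A = A} {μ} μDᵢ∼0 shift))
  where
  poincare-kernel : IsIndicatorSeries (Kernel A) (poincare ρ)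
  poincare-kernel n = rank-deg-zero {A = A} {combo n} A-sym (deg-combo n) (rk n)

complete-symmetric : ∀ {V} → IsSymmetric (complete V)
complete-symmetric u v with u Fin.≟ v | v Fin.≟ u
... | yes _   | yes _   = refl
... | yes u≡v | no  v≢u = ⊥-elim (v≢u (sym u≡v))
... | no  u≢v | yes v≡u = ⊥-elim (u≢v (sym v≡u))
... | no  _   | no  _   = refl

divisor-complete : ∀ {V} (f : Fin V → ℤ) u → divisor (complete V) f u ≡ + V * f u - sumFin f
divisor-complete {V} f u =
  trans (sumFin-cong edge)
        (trans (sumFin-distrib-- (λ _ → f u) f) (cong (_- sumFin f) (sumFin-const V (f u))))
  where
  edge : ∀ v → + complete V u v * (f u - f v) ≡ f u - f v
  edge v with u Fin.≟ v
  ... | yes refl = trans (ℤP.*-zeroˡ (f u - f u)) (sym (ℤP.+-inverseʳ (f u)))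
  ... | no  _    = ℤP.*-identityˡ (f u - f v)

Dᵢ-order-complete : ∀ {k} (i : Fin k) → (suc k ·ᴰ Dᵢ i) ∼⟨ complete (suc k) ⟩ zeroDiv
Dᵢ-order-complete {k} i =
  Dᵢ i , λ u → trans (cong (_-_ (+ suc k * Dᵢ i u)) (sym (deg-Dᵢ i))) (sym (divisor-complete (Dᵢ i) u))

pt-inject₁ : ∀ {k} (i j : Fin k) → pt (inject₁ i) (inject₁ j) ≡ pt i j
pt-inject₁ i j with i Fin.≟ j
... | yes refl = pt-≡ refl
... | no  i≢j  = pt-≢ (i≢j ∘ FinP.inject₁-injective)

combo-inject₁ : ∀ {k} (x : Fin k → ℕ) j → combo x (inject₁ j) ≡ + x j
combo-inject₁ {k} x j =
  trans (sumFin-cong λ i → cong (+ x i *_)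
          (trans (cong₂ _-_ (pt-inject₁ i j) (pt-≢ (FinP.fromℕ≢inject₁ {i = j})))
                 (trans (ℤP.+-identityʳ (pt i j)) (pt-comm i j))))
        (sumFin-*-pt j (λ i → + x i))

combo-fromℕ : ∀ {k} (x : Fin k → ℕ) → combo x (fromℕ k) ≡ - sumFin (λ i → + x i)
combo-fromℕ {k} x =
  trans (sumFin-cong λ i →
           trans (cong (+ x i *_) (cong₂ _-_ (pt-≢ {v = inject₁ i} {fromℕ k} (FinP.fromℕ≢inject₁ ∘ sym))
                                             (pt-≡ {v = fromℕ k} refl)))
                 (times-1 (+ x i)))
        (sumFin-neg (λ i → + x i))
  where
  times-1 : ∀ a → a * (0ℤ - 1ℤ) ≡ - a
  times-1 = solve-∀

inject₁-or-fromℕ : ∀ {k} (u : Fin (suc k)) → (Σ[ j ∈ Fin k ] u ≡ inject₁ j) ⊎ u ≡ fromℕ k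
inject₁-or-fromℕ {zero}  zero    = inj₂ refl
inject₁-or-fromℕ {suc k} zero    = inj₁ (zero , refl)
inject₁-or-fromℕ {suc k} (suc u) = Sum.map (Product.map suc (cong suc)) (cong suc) (inject₁-or-fromℕ u)

kernel-complete-constant : ∀ {k} {x : Fin k → ℕ} {c} → (∀ i → x i ≡ c) → Kernel (complete (suc k)) x
kernel-complete-constant {k} {x} {c} x≡c = f , λ u → at u (inject₁-or-fromℕ u)
  where
  f : Fin (suc k) → ℤ
  f u = - + c * pt (fromℕ k) u
  sum-f : sumFin f ≡ - + c
  sum-f = trans (sym (*-distribˡ-sumFin (- + c) (pt (fromℕ k))))
                (trans (cong (- + c *_) (deg-pt (fromℕ k))) (ℤP.*-identityʳ (- + c)))
  divisor-f : ∀ u → divisor (complete (suc k)) f u ≡ + suc k * (- + c * pt (fromℕ k) u) - - + c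
  divisor-f u = trans (divisor-complete f u) (cong (_-_ (+ suc k * f u)) sum-f)
  at : ∀ u → (Σ[ j ∈ Fin k ] u ≡ inject₁ j) ⊎ u ≡ fromℕ k →
       combo x u - 0ℤ ≡ divisor (complete (suc k)) f u
  at u (inj₁ (j , refl)) =
    trans (trans (ℤP.+-identityʳ (combo x (inject₁ j))) (trans (combo-inject₁ x j) (cong +_ (x≡c j))))
          (sym (trans (divisor-f (inject₁ j)) (trans (cong (λ p → + suc k * (- + c * p) - - + c)
                                                            (pt-≢ (FinP.fromℕ≢inject₁ {i = j})))
                                                      (collapse (+ suc k) (+ c)))))
    where
    collapse : ∀ n c → n * (- c * 0ℤ) - - c ≡ c
    collapse = solve-∀
  at u (inj₂ refl) =
    trans (trans (ℤP.+-identityʳ (combo x (fromℕ k)))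
                 (trans (combo-fromℕ x) (cong -_ (trans (sumFin-cong (cong +_ ∘ x≡c)) (sumFin-const k (+ c))))))
          (sym (trans (divisor-f (fromℕ k)) (trans (cong (λ p → + suc k * (- + c * p) - - + c) (pt-≡ refl))
                                                  (collapse (+ k) (+ c)))))
    where
    collapse : ∀ n c → (1ℤ + n) * (- c * 1ℤ) - - c ≡ - (n * c)
    collapse = solve-∀

≡-mod-<ℕ : ∀ {a b n} c → a < suc n → b < suc n → a ≡ b ℕ.+ c ℕ.* suc n → a ≡ b
≡-mod-<ℕ {a} {b} {n} c a<N b<N refl =
  trans (sym (m<n⇒m%n≡m a<N)) (trans ([m+kn]%n≡m%n b c (suc n)) (m<n⇒m%n≡m b<N))

≡-mod-< : ∀ {a b n} c → a < suc n → b < suc n → + a ≡ + b + + suc n * c → a ≡ b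
≡-mod-< {a} {b} {n} (+ c) a<N b<N eq =
  ≡-mod-<ℕ c a<N b<N (ℤP.+-injective (trans eq
    (trans (cong (_+_ (+ b)) (trans (sym (ℤP.pos-* (suc n) c)) (cong +_ (ℕP.*-comm (suc n) c))))
           (sym (ℤP.pos-+ b (c ℕ.* suc n))))))
≡-mod-< {a} {b} {n} ℤ.-[1+ c ] a<N b<N eq =
  sym (≡-mod-< (+ suc c) b<N a<N
    (trans (rebalance (+ b) (+ suc n) ℤ.-[1+ c ]) (cong (λ z → z + + suc n * + suc c) (sym eq))))
  where
  rebalance : ∀ b m c → b ≡ b + m * c + m * (- c)
  rebalance = solve-∀

kernel-complete-below⇒constant : ∀ {k} {x : Fin k → ℕ} → Pointwise _<_ x (λ _ → suc k) →
                                 Kernel (complete (suc k)) x → ∀ i j → x i ≡ x j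
kernel-complete-below⇒constant {k} {x} x<N (f , x∼0) i j =
  ≡-mod-< (f (inject₁ i) - f (inject₁ j)) (x<N i) (x<N j)
    (trans (x-via-f i) (trans (shift (+ suc k) (f (inject₁ i)) (f (inject₁ j)) (sumFin f))
                              (cong (_+ + suc k * (f (inject₁ i) - f (inject₁ j))) (sym (x-via-f j)))))
  where
  x-via-f : ∀ i → + x i ≡ + suc k * f (inject₁ i) - sumFin f
  x-via-f i = trans (sym (combo-inject₁ x i))
                    (trans (sym (ℤP.+-identityʳ (combo x (inject₁ i))))
                           (trans (x∼0 (inject₁ i)) (divisor-complete f (inject₁ i))))
  shift : ∀ n a b s → n * a - s ≡ (n * b - s) + n * (a - b)
  shift = solve-∀

Diagonal : ∀ {k} → ℕ → (Fin k → ℕ) → Set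
Diagonal N x = Σ[ c ∈ ℕ ] c < N × (∀ i → x i ≡ c)

InB-complete⇔Diagonal : ∀ {k} (x : Fin (suc k) → ℕ) →
                        InB (complete (suc (suc k))) (λ _ → suc (suc k)) x ⇔ Diagonal (suc (suc k)) x
InB-complete⇔Diagonal x = mk⇔
  (λ (x<N , x∈ker) → x zero , x<N zero , λ i → kernel-complete-below⇒constant x<N x∈ker i zero)
  (λ (c , c<N , x≡c) → (λ i → subst (_< _) (sym (x≡c i)) c<N) , kernel-complete-constant x≡c)

-- The coefficientwise form of (1 - t) Σ_{c<N} t^c = 1 - t^N for t = z_1⋯z_k.
module _ {k} (N : ℕ) {H : Series (suc k)} (H-diagonal : IsIndicatorSeries (Diagonal N) H) where

  private
    by-coefficients : ∀ {a b c d a' b' c' d' : ℤ} → a ≡ a' → b ≡ b' → c ≡ c' → d ≡ d' →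
                      a' - b' ≡ c' - d' → a - b ≡ c - d
    by-coefficients refl refl refl refl eq = eq

  diagonal-extensional : Extensional H
  diagonal-extensional x≗y = indicator-≡ H-diagonal H-diagonal (mk⇔
    (λ (c , c<N , x≡c) → c , c<N , λ i → trans (sym (x≗y i)) (x≡c i))
    (λ (c , c<N , y≡c) → c , c<N , λ i → trans (x≗y i) (y≡c i)))

  diagonal-constant : ∀ {x c} → (∀ i → x i ≡ c) → (c < N × H x ≡ 1ℤ) ⊎ (¬ c < N × H x ≡ 0ℤ)
  diagonal-constant {x} {c} x≡c with H-diagonal x
  ... | inj₁ ((c' , c'<N , x≡c') , Hx≡1) = inj₁ (subst (_< N) (trans (sym (x≡c' zero)) (x≡c zero)) c'<N , Hx≡1)
  ... | inj₂ (¬diagonal , Hx≡0)          = inj₂ ((λ c<N → ¬diagonal (c , c<N , x≡c)) , Hx≡0)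

  diagonal-nonconstant : ∀ {x} → ¬ (∀ i → x i ≡ x zero) → H x ≡ 0ℤ
  diagonal-nonconstant {x} ¬const with H-diagonal x
  ... | inj₁ ((c , _ , x≡c) , _) = ⊥-elim (¬const (λ i → trans (x≡c i) (sym (x≡c zero))))
  ... | inj₂ (_ , Hx≡0)          = Hx≡0

  -- What ⊗-mono says about the coefficient B of H ⊗ z_1⋯z_k at n.
  Shifted : (Fin (suc k) → ℕ) → ℤ → Set
  Shifted n B = (Pointwise _≤_ (λ _ → 1) n × B ≡ H (λ i → n i ∸ 1)) ⊎
                (¬ Pointwise _≤_ (λ _ → 1) n × B ≡ 0ℤ)

  shifted-zero : ∀ {n B} → n zero ≡ 0 → Shifted n B → B ≡ 0ℤ
  shifted-zero n₀≡0 (inj₁ (1≤n , _)) = ⊥-elim (ℕP.<-irrefl refl (subst (1 ≤_) n₀≡0 (1≤n zero)))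
  shifted-zero n₀≡0 (inj₂ (_ , B≡0)) = B≡0

  shifted-suc : ∀ {n B c} → (∀ i → n i ≡ suc c) → Shifted n B → B ≡ H (λ i → n i ∸ 1)
  shifted-suc n≡1+c (inj₁ (_ , B≡))   = B≡
  shifted-suc n≡1+c (inj₂ (1≰n , _)) = ⊥-elim (1≰n λ i → subst (1 ≤_) (sym (n≡1+c i)) (s≤s z≤n))

  one-positive : ∀ {n : Fin (suc k) → ℕ} {c} → n zero ≡ suc c → one n ≡ 0ℤ
  one-positive n₀≡1+c = mono-≢ (λ _ → 0) λ 0≡n → ℕP.0≢1+n (trans (0≡n zero) n₀≡1+c)

  telescope-constant : ∀ {n B} c → (∀ i → n i ≡ c) → Shifted n B → H n - B ≡ one n - mono (λ _ → N) n
  telescope-constant {n} zero n≡0 shifted with diagonal-constant n≡0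
  ... | inj₁ (0<N , Hn≡1) =
    by-coefficients Hn≡1 (shifted-zero (n≡0 zero) shifted) (mono-≡ (λ _ → 0) (sym ∘ n≡0))
                    (mono-≢ (λ _ → N) λ N≡n → ℕP.<⇒≢ 0<N (sym (trans (N≡n zero) (n≡0 zero)))) refl
  ... | inj₂ (0≮N , Hn≡0) =
    by-coefficients Hn≡0 (shifted-zero (n≡0 zero) shifted) (mono-≡ (λ _ → 0) (sym ∘ n≡0))
                    (mono-≡ (λ _ → N) λ i → trans (ℕP.n≤0⇒n≡0 (ℕP.≮⇒≥ 0≮N)) (sym (n≡0 i))) refl
  telescope-constant {n} (suc c) n≡c shifted
    with diagonal-constant n≡c | diagonal-constant {x = λ i → n i ∸ 1} {c} (λ i → cong (_∸ 1) (n≡c i))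
  ... | inj₁ (1+c<N , Hn≡1) | inj₁ (_ , Hn-1≡1) =
    by-coefficients Hn≡1 (trans (shifted-suc n≡c shifted) Hn-1≡1) (one-positive {n} (n≡c zero))
                    (mono-≢ (λ _ → N) λ N≡n → ℕP.<⇒≢ 1+c<N (sym (trans (N≡n zero) (n≡c zero)))) refl
  ... | inj₁ (1+c<N , _)    | inj₂ (c≮N , _) = ⊥-elim (c≮N (ℕP.<⇒≤ 1+c<N))
  ... | inj₂ (1+c≮N , Hn≡0) | inj₁ (c<N , Hn-1≡1) =
    by-coefficients Hn≡0 (trans (shifted-suc n≡c shifted) Hn-1≡1) (one-positive {n} (n≡c zero))
                    (mono-≡ (λ _ → N) λ i → trans (ℕP.≤-antisym (ℕP.≮⇒≥ 1+c≮N) c<N) (sym (n≡c i)))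
                    refl
  ... | inj₂ (_ , Hn≡0)     | inj₂ (c≮N , Hn-1≡0) =
    by-coefficients Hn≡0 (trans (shifted-suc n≡c shifted) Hn-1≡0) (one-positive {n} (n≡c zero))
                    (mono-≢ (λ _ → N) λ N≡n → c≮N (subst (c <_) (sym (trans (N≡n zero) (n≡c zero)))
                                                                (ℕP.n<1+n c)))
                    refl

  telescope : ∀ n {B} → Shifted n B → H n - B ≡ one n - mono (λ _ → N) n
  telescope n shifted with all? (λ i → n i ℕ.≟ n zero)
  ... | yes const = telescope-constant (n zero) const shifted
  ... | no ¬const =
    by-coefficients (diagonal-nonconstant ¬const) (B≡0 shifted)
                    (mono-≢ (λ _ → 0) λ 0≡n → ¬const λ i → trans (sym (0≡n i)) (0≡n zero))
                    (mono-≢ (λ _ → N) λ N≡n → ¬const λ i → trans (sym (N≡n i)) (N≡n zero)) refl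
    where
    B≡0 : ∀ {B} → Shifted n B → B ≡ 0ℤ
    B≡0 (inj₁ (1≤n , B≡)) =
      trans B≡ (diagonal-nonconstant λ eq → ¬const λ i → ℕP.∸-cancelʳ-≡ (1≤n i) (1≤n zero) (eq i))
    B≡0 (inj₂ (_ , B≡0)) = B≡0

  diagonal-⊗-1-z : H ⊗ (one ⊖ mono (λ _ → 1)) ≗ one ⊖ mono (λ _ → N)
  diagonal-⊗-1-z n =
    begin
      (H ⊗ (one ⊖ mono (λ _ → 1))) n
    ≡⟨ ⊗-distribˡ-⊖ H one (mono (λ _ → 1)) n ⟩
      (H ⊗ one) n - (H ⊗ mono (λ _ → 1)) n
    ≡⟨ cong (_- (H ⊗ mono (λ _ → 1)) n) (⊗-one diagonal-extensional n) ⟩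
      H n - (H ⊗ mono (λ _ → 1)) n
    ≡⟨ telescope n (⊗-mono (λ _ → 1) diagonal-extensional n) ⟩
      one n - mono (λ _ → N) n
    ∎
    where open ≡-Reasoning

corollary1 :
    ((k : ℕ) → 1 ≤ k → (A : Mult (suc k)) → IsMultigraph A → Connected A →
     (μ : Fin k → ℕ) → (∀ i → IsOrder A (Dᵢ i) (μ i)) →
     (ρ : (Fin k → ℕ) → ℤ) → (∀ n → IsRank A (combo n) (ρ n)) →
     (num : Series k) → IsIndicatorSeries (InB A μ) num →
     ∀ n → (poincare ρ ⊗ denominator μ) n ≡ num n)
    ×
    ((k : ℕ) → 1 ≤ k →
     (ρ : (Fin k → ℕ) → ℤ) → (∀ n → IsRank (complete (suc k)) (combo n) (ρ n)) →
     ∀ n → ((poincare ρ ⊗ denominator (λ _ → suc k)) ⊗ (one ⊖ mono (λ _ → 1))) n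
           ≡ (one ⊖ mono (λ _ → suc k)) n)
corollary1 =
  (λ k _ A (A-symmetric , _) _ μ μ-order ρ rank num num-indicator →
     indicator-unique (poincare⊗denominator-indicator A-symmetric (proj₁ ∘ proj₂ ∘ μ-order) rank)
                      num-indicator)
  ,
  λ { zero () ; (suc k) _ ρ rank →
        diagonal-⊗-1-z (suc (suc k))
          (indicator-⇔ (poincare⊗denominator-indicator complete-symmetric Dᵢ-order-complete rank)
                       InB-complete⇔Diagonal) }
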